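{- Let $\tau$ and $\sigma$ be two primitive substitutions on an alphabet $A$ with $d$ letters sharing the same non-periodic fixed point $x=\sigma^\omega(a)=\tau^\omega(a)$. Let $u$ be a non-empty prefix of $x$ for which there exist positive integers $i,j$ with $\tau_u^i=\sigma_u^j$, and suppose the set $\{V(w):w\in\mathcal{R}_{x,u}\}$ generates $\mathbb{Z}^d$. Then there exist two positive integers $i$ and $j$ such that $\tau^i=\sigma^j$.
   Context: A substitution is primitive if its incidence matrix (entry $(i,j)$ = number of occurrences of $i$ in $\sigma(j)$) has a power with strictly positive entries; $\sigma^\omega(a)=\lim_n\sigma^n(a)$ for $\sigma$ prolongable on $a$ ($\sigma(a)=aw$, $w$ non-empty, $|\sigma^n(a)|\to\infty$). For uniformly recurrent $x$ and non-empty prefix $u$, a return word to $u$ is $x_{[i,j-1]}$ with $i<j$ successive occurrences of $u$ in $x$; $\mathcal{R}_{x,u}$ is the (finite) set of return words; $x=m_0m_1\cdots$ uniquely with $m_i\in\mathcal{R}_{x,u}$; $R_{x,u}=\{1,\dots,\#\mathcal{R}_{x,u}\}$ and $\Theta_{x,u}:R_{x,u}\to\mathcal{R}_{x,u}$ enumerates the return words by order of first appearance in $(m_n)$, extended to a morphism. The return substitution $\sigma_u$ is the unique substitution on $R_{x,u}$ with $\Theta_{x,u}\circ\sigma_u=\sigma\circ\Theta_{x,u}$ (similarly $\tau_u$). $V(w)\in\mathbb{Z}^d$ is the Parikh vector of $w$ (entry of index $c$ = number of occurrences of $c$ in $w$). -}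

module Defs where

open import Data.Nat using (ℕ; zero; suc; _+_; _*_; _∸_; _<_; _≤_)
open import Data.Fin using (Fin; toℕ; _≟_) renaming (_<_ to _<ᶠ_)
open import Data.List using (List; []; _∷_; length; lookup; filter; concatMap; applyUpTo; [_])
open import Data.Integer using (ℤ; +_) renaming (_+_ to _+ℤ_; _*_ to _*ℤ_)
open import Data.Product using (Σ; ∃; _×_; _,_)
open import Relation.Binary.PropositionalEquality using (_≡_; _≢_)
open import Relation.Nullary using (¬_)

Word : ℕ → Set
Word d = List (Fin d)

InfWord : ℕ → Set
InfWord d = ℕ → Fin d

Morph : ℕ → ℕ → Set
Morph r d = Fin r → Word d

Subst : ℕ → Set
Subst d = Morph d d

apply : ∀ {r d} → Morph r d → Word r → Word d
apply σ w = concatMap σ w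

pow : ∀ {d} → Subst d → ℕ → Subst d
pow σ zero    b = [ b ]
pow σ (suc n) b = apply σ (pow σ n b)

count : ∀ {d} → Fin d → Word d → ℕ
count c w = length (filter (_≟ c) w)

sumℕ : ∀ {n} → (Fin n → ℕ) → ℕ
sumℕ {zero}  f = 0
sumℕ {suc n} f = f Data.Fin.zero + sumℕ (λ k → f (Data.Fin.suc k))

sumℤ : ∀ {n} → (Fin n → ℤ) → ℤ
sumℤ {zero}  f = + 0
sumℤ {suc n} f = f Data.Fin.zero +ℤ sumℤ (λ k → f (Data.Fin.suc k))

Mat : ℕ → Set
Mat d = Fin d → Fin d → ℕ

_⊗_ : ∀ {d} → Mat d → Mat d → Mat d
(M ⊗ N) i j = sumℕ (λ k → M i k * N k j)

idMat : ∀ {d} → Mat d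
idMat i j with i ≟ j
... | Relation.Nullary.yes _ = 1
... | Relation.Nullary.no  _ = 0

matPow : ∀ {d} → Mat d → ℕ → Mat d
matPow M zero    = idMat
matPow M (suc n) = M ⊗ matPow M n

incidence : ∀ {d} → Subst d → Mat d
incidence σ i j = count i (σ j)

Primitive : ∀ {d} → Subst d → Set
Primitive {d} σ = ∃ λ k → (i j : Fin d) → 0 < matPow (incidence σ) (suc k) i j

PrefixOf : ∀ {d} → Word d → InfWord d → Set
PrefixOf w x = (k : Fin (length w)) → x (toℕ k) ≡ lookup w k

Prolongable : ∀ {d} → Subst d → Fin d → Set
Prolongable σ a =
  (∃ λ w → (σ a ≡ a ∷ w) × (w ≢ []))
  × ((N : ℕ) → ∃ λ n → N ≤ length (pow σ n a))

IsFixedPointω : ∀ {d} → Subst d → Fin d → InfWord d → Set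
IsFixedPointω σ a x = Prolongable σ a × ((n : ℕ) → PrefixOf (pow σ n a) x)

Periodic : ∀ {d} → InfWord d → Set
Periodic x = ∃ λ p → (0 < p) × ((n : ℕ) → x (n + p) ≡ x n)

OccursAt : ∀ {d} → Word d → InfWord d → ℕ → Set
OccursAt u x i = PrefixOf u (λ k → x (i + k))

slice : ∀ {d} → InfWord d → ℕ → ℕ → Word d
slice x i n = applyUpTo (λ k → x (i + k)) n

V : ∀ {d} → Word d → Fin d → ℤ
V w c = + count c w

-- Θ_{x,u} : Fin r → return words, characterised as in the paper:
-- pos enumerates the successive occurrences of u in x (pos 0 = 0 since u is a prefix),
-- m_n = x_[pos n, pos (n+1) - 1] is the decomposition x = m_0 m_1 ⋯,
-- code n ∈ Fin r is the index with Θ (code n) = m_n, Θ is injective, every index is used,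
-- and indices are numbered by order of first appearance in (m_n).
record IsReturnEnum {d} (x : InfWord d) (u : Word d) (r : ℕ) (Θ : Morph r d) : Set where
  field
    pos        : ℕ → ℕ
    pos-zero   : pos 0 ≡ 0
    pos-mono   : (n : ℕ) → pos n < pos (suc n)
    pos-occ    : (n : ℕ) → OccursAt u x (pos n)
    pos-all    : (i : ℕ) → OccursAt u x i → ∃ λ n → pos n ≡ i
    code       : ℕ → Fin r
    code-spec  : (n : ℕ) → Θ (code n) ≡ slice x (pos n) (pos (suc n) ∸ pos n)
    Θ-inj      : (k l : Fin r) → Θ k ≡ Θ l → k ≡ l
    code-surj  : (k : Fin r) → ∃ λ n → code n ≡ k
    first-order : (k l : Fin r) → k <ᶠ l → (n : ℕ) → code n ≡ l →
                  ∃ λ m → (m < n) × (code m ≡ k)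

IsReturnSubst : ∀ {d r} → Subst d → Morph r d → Subst r → Set
IsReturnSubst σ Θ σu = ∀ k → apply Θ (σu k) ≡ apply σ (Θ k)

_≗ˢ_ : ∀ {d} → Subst d → Subst d → Set
σ ≗ˢ τ = ∀ b → σ b ≡ τ b

GeneratesZd : ∀ {d r} → Morph r d → Set
GeneratesZd {d} {r} Θ = (v : Fin d → ℤ) →
  ∃ λ (coef : Fin r → ℤ) → (c : Fin d) → v c ≡ sumℤ (λ k → coef k *ℤ V (Θ k) c)

-- τ^i and σ^j agree on every return word, because Θ intertwines τ_u^i with τ^i and σ_u^j with
-- σ^j. Lengths of images are linear in the Parikh vector, and the Parikh vectors of the return
-- words span ℤ^d, so τ^i and σ^j give every letter an image of the same length; spanning also
-- forces every letter to occur in a return word, hence in x. Both τ^i and σ^j map prefixes of x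
-- to prefixes of x, so for x_m = b the images of x_[0,m] are prefixes of x of equal length, and
-- cancelling the images of x_[0,m) gives τ^i(b) = σ^j(b).

module Submission where

open import Defs
open import Data.Nat using (ℕ; zero; suc; _<_; _≤_; s≤s; _<?_)
import Data.Nat as ℕ
open import Data.Nat.Properties using (suc-injective; ≮⇒≥; n≤0⇒n≡0)
open import Data.Fin using (Fin; zero; suc; _≟_)
open import Data.Fin.Properties using (any?)
open import Data.Integer using (ℤ; +_; _+_; _*_)
import Data.Integer.Properties as ℤ
open import Algebra.Properties.Semiring.Sum ℤ.+-*-semiring
  using (sum; sum-cong-≗; sum-replicate-zero; ∑-distrib-+; ∑-comm; *-distribˡ-sum; *-distribʳ-sum)
open import Data.Vec.Functional using (tail)
open import Data.List using (List; []; _∷_; [_]; _++_; length; filter; applyUpTo)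
open import Data.List.Properties
  using ( ++-identityʳ; length-++; ∷-injectiveʳ; filter-++; filter-accept; concatMap-++; concatMap-pure
        ; applyUpTo-∷ʳ; lookup-applyUpTo)
open import Data.List.Effectful using (module MonadProperties)
open import Data.List.Membership.Propositional using (_∈_)
open import Data.List.Membership.Propositional.Properties using (∈-filter⁻; ∈-applyUpTo⁻)
open import Data.List.Relation.Unary.Any using (here)
open import Data.Product using (∃; _×_; _,_)
open import Data.Empty using (⊥-elim)
open import Relation.Binary.PropositionalEquality
  using (_≡_; _≢_; refl; sym; trans; cong; cong₂; subst; module ≡-Reasoning)
open import Relation.Nullary using (¬_; yes; no)

open ≡-Reasoning
open IsReturnEnum using (pos; code-spec; code-surj)

apply-++ : ∀ {r d} (f : Morph r d) (w v : Word r) → apply f (w ++ v) ≡ apply f w ++ apply f v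
apply-++ f = concatMap-++ f

apply-pow-zero : ∀ {d} (σ : Subst d) (w : Word d) → apply (pow σ 0) w ≡ w
apply-pow-zero σ = concatMap-pure

apply-pow-suc : ∀ {d} (σ : Subst d) (n : ℕ) (w : Word d) →
  apply (pow σ (suc n)) w ≡ apply σ (apply (pow σ n) w)
apply-pow-suc σ n w = MonadProperties.associative w (pow σ n) σ

apply-pow-pow : ∀ {d} (σ : Subst d) (m n : ℕ) (b : Fin d) →
  apply (pow σ m) (pow σ n b) ≡ pow σ (m ℕ.+ n) b
apply-pow-pow σ zero    n b = apply-pow-zero σ (pow σ n b)
apply-pow-pow σ (suc m) n b =
  trans (apply-pow-suc σ m (pow σ n b)) (cong (apply σ) (apply-pow-pow σ m n b))

IsReturnSubst-apply : ∀ {r d} {σ : Subst d} {Θ : Morph r d} {σu : Subst r} →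
  IsReturnSubst σ Θ σu → ∀ w → apply Θ (apply σu w) ≡ apply σ (apply Θ w)
IsReturnSubst-apply h []      = refl
IsReturnSubst-apply {σ = σ} {Θ} {σu} h (k ∷ w) = begin
  apply Θ (σu k ++ apply σu w)            ≡⟨ apply-++ Θ (σu k) _ ⟩
  apply Θ (σu k) ++ apply Θ (apply σu w)  ≡⟨ cong₂ _++_ (h k) (IsReturnSubst-apply h w) ⟩
  apply σ (Θ k) ++ apply σ (apply Θ w)    ≡⟨ apply-++ σ (Θ k) _ ⟨
  apply σ (Θ k ++ apply Θ w)              ∎

IsReturnSubst-pow : ∀ {r d} {σ : Subst d} {Θ : Morph r d} {σu : Subst r} →
  IsReturnSubst σ Θ σu → ∀ n → IsReturnSubst (pow σ n) Θ (pow σu n)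
IsReturnSubst-pow {σ = σ} {Θ} h zero    k =
  trans (++-identityʳ (Θ k)) (sym (apply-pow-zero σ (Θ k)))
IsReturnSubst-pow {σ = σ} {Θ} {σu} h (suc n) k = begin
  apply Θ (apply σu (pow σu n k))  ≡⟨ IsReturnSubst-apply h (pow σu n k) ⟩
  apply σ (apply Θ (pow σu n k))   ≡⟨ cong (apply σ) (IsReturnSubst-pow h n k) ⟩
  apply σ (apply (pow σ n) (Θ k))  ≡⟨ apply-pow-suc σ n (Θ k) ⟨
  apply (pow σ (suc n)) (Θ k)      ∎

infix 7 _·_

_·_ : ∀ {d} → (Fin d → ℤ) → (Fin d → ℤ) → ℤ
u · v = sum (λ c → u c * v c)

sumℤ≡sum : ∀ {n} (f : Fin n → ℤ) → sumℤ f ≡ sum f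
sumℤ≡sum {zero}  f = refl
sumℤ≡sum {suc n} f = cong (_+_ (f zero)) (sumℤ≡sum (λ k → f (suc k)))

·-distribʳ-+ : ∀ {d} (u v ℓ : Fin d → ℤ) → (λ c → u c + v c) · ℓ ≡ u · ℓ + v · ℓ
·-distribʳ-+ u v ℓ = trans (sum-cong-≗ (λ c → ℤ.*-distribʳ-+ (ℓ c) (u c) (v c)))
                           (∑-distrib-+ (λ c → u c * ℓ c) (λ c → v c * ℓ c))

·-combination : ∀ {r d} (coef : Fin r → ℤ) (w : Fin r → Fin d → ℤ) (ℓ : Fin d → ℤ) →
  (λ c → sum (λ k → coef k * w k c)) · ℓ ≡ sum (λ k → coef k * (w k · ℓ))
·-combination coef w ℓ = begin
  sum (λ c → sum (λ k → coef k * w k c) * ℓ c)    ≡⟨ sum-cong-≗ (λ c → *-distribʳ-sum (ℓ c) (λ k → coef k * w k c)) ⟩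
  sum (λ c → sum (λ k → coef k * w k c * ℓ c))    ≡⟨ sum-cong-≗ (λ c → sum-cong-≗ (λ k → ℤ.*-assoc (coef k) (w k c) (ℓ c))) ⟩
  sum (λ c → sum (λ k → coef k * (w k c * ℓ c)))  ≡⟨ ∑-comm (λ c k → coef k * (w k c * ℓ c)) ⟩
  sum (λ k → sum (λ c → coef k * (w k c * ℓ c)))  ≡⟨ sum-cong-≗ (λ k → *-distribˡ-sum (coef k) (λ c → w k c * ℓ c)) ⟨
  sum (λ k → coef k * (w k · ℓ))                  ∎

count-++ : ∀ {d} (c : Fin d) (w v : Word d) → count c (w ++ v) ≡ count c w ℕ.+ count c v
count-++ c w v = trans (cong length (filter-++ (_≟ c) w v)) (length-++ (filter (_≟ c) w))

count-suc-[] : ∀ {d} (c b : Fin d) → count (suc c) [ suc b ] ≡ count c [ b ]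
count-suc-[] c b with b ≟ c
... | yes _ = refl
... | no  _ = refl

·-zeroˡ : ∀ {d} (ℓ : Fin d → ℤ) → (λ _ → + 0) · ℓ ≡ + 0
·-zeroˡ {d} ℓ = sum-replicate-zero d

V-[]-· : ∀ {d} (b : Fin d) (ℓ : Fin d → ℤ) → V [ b ] · ℓ ≡ ℓ b
V-[]-· zero ℓ = begin
  + 1 * ℓ zero + (λ _ → + 0) · tail ℓ  ≡⟨ cong₂ _+_ (ℤ.*-identityˡ (ℓ zero)) (·-zeroˡ (tail ℓ)) ⟩
  ℓ zero + + 0                         ≡⟨ ℤ.+-identityʳ (ℓ zero) ⟩
  ℓ zero                               ∎
V-[]-· (suc b) ℓ = begin
  + 0 + sum (λ c → V [ suc b ] (suc c) * ℓ (suc c))  ≡⟨ ℤ.+-identityˡ _ ⟩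
  sum (λ c → V [ suc b ] (suc c) * ℓ (suc c))        ≡⟨ sum-cong-≗ (λ c → cong (λ n → + n * ℓ (suc c)) (count-suc-[] c b)) ⟩
  V [ b ] · tail ℓ                                   ≡⟨ V-[]-· b (tail ℓ) ⟩
  ℓ (suc b)                                          ∎

lengths : ∀ {d} → Subst d → Fin d → ℤ
lengths φ c = + length (φ c)

length-apply : ∀ {d} (φ : Subst d) (w : Word d) → + length (apply φ w) ≡ V w · lengths φ
length-apply φ []      = sym (·-zeroˡ (lengths φ))
length-apply φ (b ∷ w) = begin
  + length (φ b ++ apply φ w)              ≡⟨ cong +_ (length-++ (φ b)) ⟩
  + (length (φ b) ℕ.+ length (apply φ w))  ≡⟨ ℤ.pos-+ (length (φ b)) _ ⟩
  lengths φ b + + length (apply φ w)       ≡⟨ cong₂ _+_ (sym (V-[]-· b (lengths φ))) (length-apply φ w) ⟩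
  V [ b ] · lengths φ + V w · lengths φ    ≡⟨ ·-distribʳ-+ (V [ b ]) (V w) (lengths φ) ⟨
  (λ c → V [ b ] c + V w c) · lengths φ    ≡⟨ sum-cong-≗ (λ c → cong (_* lengths φ c) V-∷) ⟩
  V (b ∷ w) · lengths φ                    ∎
  where
    V-∷ : ∀ {c} → V [ b ] c + V w c ≡ V (b ∷ w) c
    V-∷ {c} = trans (sym (ℤ.pos-+ (count c [ b ]) _)) (cong +_ (sym (count-++ c [ b ] w)))

Spans : ∀ {r d} → (Fin r → Fin d → ℤ) → Set
Spans {r} {d} w = (v : Fin d → ℤ) →
  ∃ λ (coef : Fin r → ℤ) → (c : Fin d) → v c ≡ sumℤ (λ k → coef k * w k c)

Spans-separates : ∀ {r d} {w : Fin r → Fin d → ℤ} → Spans w → (ℓ ℓ′ : Fin d → ℤ) →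
  (∀ k → w k · ℓ ≡ w k · ℓ′) → ∀ b → ℓ b ≡ ℓ′ b
Spans-separates {w = w} span ℓ ℓ′ agree b with span (V [ b ])
... | coef , V[b]≡ = begin
  ℓ b                              ≡⟨ V-[]-· b ℓ ⟨
  V [ b ] · ℓ                      ≡⟨ expand ℓ ⟩
  sum (λ k → coef k * (w k · ℓ))   ≡⟨ sum-cong-≗ (λ k → cong (coef k *_) (agree k)) ⟩
  sum (λ k → coef k * (w k · ℓ′))  ≡⟨ expand ℓ′ ⟨
  V [ b ] · ℓ′                     ≡⟨ V-[]-· b ℓ′ ⟩
  ℓ′ b                             ∎
  where
    expand : (ℓ : Fin _ → ℤ) → V [ b ] · ℓ ≡ sum (λ k → coef k * (w k · ℓ))
    expand ℓ =
      trans (sum-cong-≗ (λ c → cong (_* ℓ c) (trans (V[b]≡ c) (sumℤ≡sum (λ k → coef k * w k c)))))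
            (·-combination coef w ℓ)

length-apply-cong : ∀ {d} {φ ψ : Subst d} → (∀ b → length (φ b) ≡ length (ψ b)) →
  ∀ w → length (apply φ w) ≡ length (apply ψ w)
length-apply-cong {φ = φ} {ψ} same w = ℤ.+-injective (begin
  + length (apply φ w)  ≡⟨ length-apply φ w ⟩
  V w · lengths φ       ≡⟨ sum-cong-≗ (λ c → cong (λ n → V w c * + n) (same c)) ⟩
  V w · lengths ψ       ≡⟨ length-apply ψ w ⟨
  + length (apply ψ w)  ∎)

Spans-V-lengths : ∀ {r d} (Θ : Morph r d) {φ ψ : Subst d} → Spans (λ k → V (Θ k)) →
  (∀ k → length (apply φ (Θ k)) ≡ length (apply ψ (Θ k))) → ∀ b → length (φ b) ≡ length (ψ b)
Spans-V-lengths Θ {φ} {ψ} span same b =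
  ℤ.+-injective (Spans-separates span (lengths φ) (lengths ψ) same-on-Θ b)
  where
    same-on-Θ : ∀ k → V (Θ k) · lengths φ ≡ V (Θ k) · lengths ψ
    same-on-Θ k = begin
      V (Θ k) · lengths φ       ≡⟨ length-apply φ (Θ k) ⟨
      + length (apply φ (Θ k))  ≡⟨ cong +_ (same k) ⟩
      + length (apply ψ (Θ k))  ≡⟨ length-apply ψ (Θ k) ⟩
      V (Θ k) · lengths ψ       ∎

count-[]-self : ∀ {d} (b : Fin d) → count b [ b ] ≡ 1
count-[]-self b = cong length (filter-accept (_≟ b) refl)

count-pos⇒∈ : ∀ {d} {b : Fin d} (w : Word d) → 0 < count b w → b ∈ w
count-pos⇒∈ {b = b} w 0<count with filter (_≟ b) w in eq | 0<count
... | y ∷ _ | _ with ∈-filter⁻ (_≟ b) {xs = w} (subst (y ∈_) (sym eq) (here refl))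
...   | y∈w , refl = y∈w

Spans-V-covers : ∀ {r d} (Θ : Morph r d) → Spans (λ k → V (Θ k)) → ∀ b → ∃ λ k → b ∈ Θ k
Spans-V-covers {r} Θ span b with any? (λ k → 0 <? count b (Θ k))
... | yes (k , 0<count) = k , count-pos⇒∈ (Θ k) 0<count
-- Otherwise the unit vector V [ b ] would be a combination of vectors with zero b-coordinate.
... | no ∄k with span (V [ b ])
...   | coef , V[b]≡ = ⊥-elim (+1≢+0 (begin
  + 1                              ≡⟨ cong +_ (count-[]-self b) ⟨
  V [ b ] b                        ≡⟨ V[b]≡ b ⟩
  sumℤ (λ k → coef k * V (Θ k) b)  ≡⟨ sumℤ≡sum (λ k → coef k * V (Θ k) b) ⟩
  sum (λ k → coef k * V (Θ k) b)   ≡⟨ sum-cong-≗ (λ k → cong (λ n → coef k * + n) (count≡0 k)) ⟩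
  sum (λ k → coef k * + 0)         ≡⟨ trans (sum-cong-≗ (λ k → ℤ.*-zeroʳ (coef k))) (sum-replicate-zero r) ⟩
  + 0                              ∎))
  where
    +1≢+0 : + 1 ≢ + 0
    +1≢+0 ()
    count≡0 : ∀ k → count b (Θ k) ≡ 0
    count≡0 k = n≤0⇒n≡0 (≮⇒≥ (λ 0<count → ∄k (k , 0<count)))

IsReturnEnum-letter : ∀ {r d} {x : InfWord d} {u : Word d} {Θ : Morph r d} →
  IsReturnEnum x u r Θ → ∀ {b k} → b ∈ Θ k → ∃ λ m → x m ≡ b
IsReturnEnum-letter {x = x} enum {b} {k} b∈Θk
  with n , refl ← code-surj enum k
  with t , _ , b≡xₜ ← ∈-applyUpTo⁻ (λ t → x (pos enum n ℕ.+ t)) (subst (b ∈_) (code-spec enum n) b∈Θk)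
  = pos enum n ℕ.+ t , sym b≡xₜ

∷-PrefixOf : ∀ {d} (x : InfWord d) {b w} → x 0 ≡ b → PrefixOf w (λ n → x (suc n)) → PrefixOf (b ∷ w) x
∷-PrefixOf x x₀≡b p zero    = x₀≡b
∷-PrefixOf x x₀≡b p (suc k) = p k

PrefixOf-++ˡ : ∀ {d} (x : InfWord d) (w : Word d) {v} → PrefixOf (w ++ v) x → PrefixOf w x
PrefixOf-++ˡ x []      p ()
PrefixOf-++ˡ x (_ ∷ w) {v} p =
  ∷-PrefixOf x (p zero) (PrefixOf-++ˡ (λ n → x (suc n)) w {v} (λ k → p (suc k)))

PrefixOf-extends : ∀ {d} (x : InfWord d) (w v : Word d) → PrefixOf w x → PrefixOf v x →
  length w ≤ length v → ∃ λ s → v ≡ w ++ s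
PrefixOf-extends x []      v       p q _         = v , refl
PrefixOf-extends x (_ ∷ w) (_ ∷ v) p q (s≤s w≤v)
  with s , v≡w++s ← PrefixOf-extends (λ n → x (suc n)) w v (λ k → p (suc k)) (λ k → q (suc k)) w≤v
  = s , cong₂ _∷_ (trans (sym (q zero)) (p zero)) v≡w++s

PrefixOf-unique : ∀ {d} (x : InfWord d) (w v : Word d) → PrefixOf w x → PrefixOf v x →
  length w ≡ length v → w ≡ v
PrefixOf-unique x []      []      p q _       = refl
PrefixOf-unique x (_ ∷ w) (_ ∷ v) p q |w|≡|v| =
  cong₂ _∷_ (trans (sym (p zero)) (q zero))
            (PrefixOf-unique (λ n → x (suc n)) w v (λ k → p (suc k)) (λ k → q (suc k)) (suc-injective |w|≡|v|))

PrefixOf-applyUpTo : ∀ {d} (x : InfWord d) n → PrefixOf (applyUpTo x n) x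
PrefixOf-applyUpTo x n k = sym (lookup-applyUpTo x n k)

IsFixedPointω-PrefixOf : ∀ {d} {σ : Subst d} {a x} → IsFixedPointω σ a x →
  ∀ i w → PrefixOf w x → PrefixOf (apply (pow σ i) w) x
IsFixedPointω-PrefixOf {σ = σ} {a} {x} ((_ , unbounded) , σⁿa⊑x) i w w⊑x
  with n , |w|≤|σⁿa| ← unbounded (length w)
  with s , σⁿa≡w++s ← PrefixOf-extends x w (pow σ n a) w⊑x (σⁿa⊑x n) |w|≤|σⁿa|
  = PrefixOf-++ˡ x (apply (pow σ i) w) (subst (λ v → PrefixOf v x) σⁱ⁺ⁿa≡ (σⁿa⊑x (i ℕ.+ n)))
  where
    σⁱ⁺ⁿa≡ : pow σ (i ℕ.+ n) a ≡ apply (pow σ i) w ++ apply (pow σ i) s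
    σⁱ⁺ⁿa≡ = begin
      pow σ (i ℕ.+ n) a                       ≡⟨ apply-pow-pow σ i n a ⟨
      apply (pow σ i) (pow σ n a)             ≡⟨ cong (apply (pow σ i)) σⁿa≡w++s ⟩
      apply (pow σ i) (w ++ s)                ≡⟨ apply-++ (pow σ i) w s ⟩
      apply (pow σ i) w ++ apply (pow σ i) s  ∎

++-cancelˡ-length : ∀ {A : Set} (w w′ : List A) {v v′} →
  length w ≡ length w′ → w ++ v ≡ w′ ++ v′ → v ≡ v′
++-cancelˡ-length []      []       _   eq = eq
++-cancelˡ-length (_ ∷ w) (_ ∷ w′) len eq = ++-cancelˡ-length w w′ (suc-injective len) (∷-injectiveʳ eq)

PrefixOf-preserving-agree : ∀ {d} {x : InfWord d} {φ ψ : Subst d} →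
  (∀ w → PrefixOf w x → PrefixOf (apply φ w) x) →
  (∀ w → PrefixOf w x → PrefixOf (apply ψ w) x) →
  (∀ b → length (φ b) ≡ length (ψ b)) → ∀ m → φ (x m) ≡ ψ (x m)
PrefixOf-preserving-agree {x = x} {φ} {ψ} φ⁺ ψ⁺ same m = begin
  φ (x m)          ≡⟨ ++-identityʳ (φ (x m)) ⟨
  apply φ [ x m ]  ≡⟨ ++-cancelˡ-length (apply φ p) (apply ψ p) (length-apply-cong same p) images ⟩
  apply ψ [ x m ]  ≡⟨ ++-identityʳ (ψ (x m)) ⟩
  ψ (x m)          ∎
  where
    p = applyUpTo x m
    q = p ++ [ x m ]
    q⊑x : PrefixOf q x
    q⊑x = subst (λ w → PrefixOf w x) (sym (applyUpTo-∷ʳ x m)) (PrefixOf-applyUpTo x (suc m))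
    images : apply φ p ++ apply φ [ x m ] ≡ apply ψ p ++ apply ψ [ x m ]
    images = begin
      apply φ p ++ apply φ [ x m ]  ≡⟨ apply-++ φ p [ x m ] ⟨
      apply φ q                     ≡⟨ PrefixOf-unique x _ _ (φ⁺ q q⊑x) (ψ⁺ q q⊑x) (length-apply-cong same q) ⟩
      apply ψ q                     ≡⟨ apply-++ ψ p [ x m ] ⟩
      apply ψ p ++ apply ψ [ x m ]  ∎

corollary4p4 : (d : ℕ) (σ τ : Subst d) (a : Fin d) (x : InfWord d) →
    Primitive σ → Primitive τ →
    IsFixedPointω σ a x → IsFixedPointω τ a x → ¬ Periodic x →
    (u : Word d) → u ≢ [] → PrefixOf u x →
    (r : ℕ) (Θ : Morph r d) → IsReturnEnum x u r Θ →
    (σu τu : Subst r) → IsReturnSubst σ Θ σu → IsReturnSubst τ Θ τu →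
    (∃ λ i → ∃ λ j → (0 < i) × (0 < j) × (pow τu i ≗ˢ pow σu j)) →
    GeneratesZd Θ →
    ∃ λ i → ∃ λ j → (0 < i) × (0 < j) × (pow τ i ≗ˢ pow σ j)
corollary4p4 _ σ τ _ x _ _ σ-fix τ-fix _ _ _ _ _ Θ enum σu τu σu-ret τu-ret (i , j , 0<i , 0<j , τuⁱ≗σuʲ) span =
  i , j , 0<i , 0<j , τⁱ≗σʲ
  where
    τⁱ∘Θ≗σʲ∘Θ : ∀ k → apply (pow τ i) (Θ k) ≡ apply (pow σ j) (Θ k)
    τⁱ∘Θ≗σʲ∘Θ k = begin
      apply (pow τ i) (Θ k)   ≡⟨ IsReturnSubst-pow τu-ret i k ⟨
      apply Θ (pow τu i k)    ≡⟨ cong (apply Θ) (τuⁱ≗σuʲ k) ⟩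
      apply Θ (pow σu j k)    ≡⟨ IsReturnSubst-pow σu-ret j k ⟩
      apply (pow σ j) (Θ k)   ∎

    τⁱ≗σʲ : pow τ i ≗ˢ pow σ j
    τⁱ≗σʲ b
      with k , b∈Θk ← Spans-V-covers Θ span b
      with m , refl ← IsReturnEnum-letter enum b∈Θk
      = PrefixOf-preserving-agree
          (IsFixedPointω-PrefixOf {x = x} τ-fix i) (IsFixedPointω-PrefixOf {x = x} σ-fix j)
          (Spans-V-lengths Θ span (λ k → cong length (τⁱ∘Θ≗σʲ∘Θ k))) m
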